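{- Let $\alpha>0$ and let $D$ be an $n$-vertex $\alpha$-expander. Then $D$ contains a directed cycle of length at least $\frac{\alpha n}{3}$.
   Context: All digraphs are finite, without loops or multiple arcs. For $U\subseteq V(D)$, $N^+(U)$ is the set of vertices not in $U$ that are heads of arcs with tails in $U$, and $N^-(U)$ is the set of vertices not in $U$ that are tails of arcs with heads in $U$. For $\alpha>0$, $D$ is an $\alpha$-expander if $|V(D)|\ge 2$ and for every $U\subseteq V(D)$ with $|U|\le\frac23|V(D)|$ we have $|N^+(U)|\ge\alpha|U|$ and $|N^-(U)|\ge\alpha|U|$.
   Formalization: The parameter α ranges over the positive rationals, both in the lemma and in the definition of an α-expander. -}

module Defs where

open import Data.Bool using (Bool; true; false; _∧_; not)
open import Data.Nat using (ℕ)
import Data.Nat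
open import Data.Fin using (Fin)
open import Data.Fin.Subset using (Subset; inside; outside; ∣_∣; _∈_; _∉_)
open import Data.Vec using (tabulate; lookup)
open import Data.List using (List; []; _∷_; length; last)
open import Data.List.Relation.Unary.Unique.Propositional using (Unique)
open import Data.List.Relation.Unary.Linked using (Linked)
open import Data.Product using (_×_)
open import Data.Maybe using (just)
open import Data.Rational using (ℚ)
import Data.Rational as ℚ
open import Relation.Binary.PropositionalEquality using (_≡_)
open import Relation.Nullary using (¬_)
open import Data.Empty using (⊥)

-- A digraph on vertex set Fin n: arc relation given as a Boolean adjacency
-- function; loops are forbidden.  (Multiple arcs cannot be represented.)
record Digraph (n : ℕ) : Set where
  field
    arc    : Fin n → Fin n → Bool
    noLoop : ∀ v → arc v v ≡ false
open Digraph public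

anyIn : {n : ℕ} → Subset n → (Fin n → Bool) → Bool
anyIn {n} U p = Data.Vec.foldr _ Data.Bool._∨_ false
                  (tabulate λ u → memb (lookup U u) ∧ p u)
  where
  memb : Data.Fin.Subset.Side → Bool
  memb inside  = true
  memb outside = false

isIn : {n : ℕ} → Subset n → Fin n → Bool
isIn U v with lookup U v
... | inside  = true
... | outside = false

fromBool : Bool → Data.Fin.Subset.Side
fromBool true  = inside
fromBool false = outside

outNbhd : {n : ℕ} → Digraph n → Subset n → Subset n
outNbhd D U = tabulate λ v → fromBool (not (isIn U v) ∧ anyIn U (λ u → arc D u v))

inNbhd : {n : ℕ} → Digraph n → Subset n → Subset n
inNbhd D U = tabulate λ v → fromBool (not (isIn U v) ∧ anyIn U (λ u → arc D v u))

ℕ→ℚ : ℕ → ℚ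
ℕ→ℚ k = ℚ._/_ (Data.Integer.+_ k) 1
  where import Data.Integer

IsExpander : {n : ℕ} → ℚ → Digraph n → Set
IsExpander {n} α D =
  (2 Data.Nat.≤ n) ×
  (∀ (U : Subset n) → 3 Data.Nat.* ∣ U ∣ Data.Nat.≤ 2 Data.Nat.* n →
     (α ℚ.* ℕ→ℚ ∣ U ∣ ℚ.≤ ℕ→ℚ ∣ outNbhd D U ∣) ×
     (α ℚ.* ℕ→ℚ ∣ U ∣ ℚ.≤ ℕ→ℚ ∣ inNbhd D U ∣))

-- a directed cycle v₁ → v₂ → … → v_k → v₁ with k ≥ 2 distinct vertices
-- (k = 2 allowed: a pair of opposite arcs; loops are excluded anyway)
ArcR : {n : ℕ} → Digraph n → Fin n → Fin n → Set
ArcR D u v = arc D u v ≡ true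

record DirectedCycle {n : ℕ} (D : Digraph n) : Set where
  field
    first    : Fin n
    rest     : List (Fin n)
    long     : 2 Data.Nat.≤ length (first ∷ rest)
    distinct : Unique (first ∷ rest)
    path     : Linked (ArcR D) (first ∷ rest)
    closing  : ∀ z → last (first ∷ rest) ≡ just z → ArcR D z first
open DirectedCycle public

cycleLength : {n : ℕ} {D : Digraph n} → DirectedCycle D → ℕ
cycleLength C = length (first C ∷ rest C)

{-# OPTIONS --safe #-}
module Submission where

-- Grow a simple path Q ending at a vertex v, keeping more than 2n/3 vertices reachable
-- from v by paths that avoid the rest of Q.  Apart from v, these vertices are covered by
-- the sets Z_x reachable from the out-neighbours x of v off Q.  If some Z_x is still
-- larger than 2n/3, extend Q by x.  Otherwise one Z_x, or a union of several, has between
-- n/3 and 2n/3 vertices.  Such a set Z has all its out-neighbours on Q, and there are at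
-- least α|Z| ≥ αn/3 of them.  Let y be the first of them on Q.  Following Q from y to v,
-- entering Z and returning to y by an arc gives a cycle that passes through all of N⁺(Z).

module Combinatorics where

  import Data.Bool as Bool
  open import Data.Bool using (Bool; true; false; _∧_; not)
  open import Data.Fin using (Fin; zero; suc; _≟_; fromℕ<)
  open import Data.Fin.Subset using (Subset; ⊥; ⁅_⁆; _∪_; _∩_; ∁; ⋃; ∣_∣; _∈_; _∉_; Nonempty)
  open import Data.Fin.Subset.Properties
    using (x∈⁅x⁆; x∈⁅y⁆⇒x≡y; ∉⊥; x∈p∪q⁻; x∈p∪q⁺; p⊆p∪q; p⊆q⇒∣p∣≤∣q∣; p⊂q⇒∣p∣<∣q∣; ∣⁅x⁆∣≡1;
           ∣⊥∣≡0; ∣p∣≤n; ∣p∣≤∣x∷p∣; _∈?_; x∈p∩q⁺; x∈p∩q⁻; x∉p⇒x∈∁p; x∈∁p⇒x∉p; x≢y⇒x∉⁅y⁆;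
           ∪-identityʳ; nonempty?; Empty-unique)
  open import Data.List using (List; []; _∷_; _++_; length; last; head; filter; map; allFin)
  open import Data.List.Properties using (++-identityʳ; length-++-≤ˡ)
  open import Data.List.Membership.Propositional using (lose; find) renaming (_∈_ to _∈ₗ_)
  open import Data.List.Membership.Propositional.Properties
    using (∈-++⁻; ∈-++⁺ˡ; ∈-++⁺ʳ; ∈-filter⁺; ∈-filter⁻; ∈-allFin)
  open import Data.List.Relation.Binary.Subset.Propositional using () renaming (_⊆_ to _⊆ₗ_)
  open import Data.List.Relation.Unary.All as All using (All; []; _∷_)
  import Data.List.Relation.Unary.All.Properties as All
  open import Data.List.Relation.Unary.All.Properties using (anti-mono; ¬Any⇒All¬)
  open import Data.List.Relation.Unary.AllPairs using ([]; _∷_)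
  open import Data.List.Relation.Unary.Any using (Any; here; there; any?)
  import Data.List.Relation.Unary.Any.Properties as Any
  import Data.List.Relation.Unary.First as First
  open import Data.List.Relation.Unary.First.Properties using (¬All⇒First; toView)
  open import Data.List.Relation.Unary.Linked as Linked using (Linked; [-]; _∷_)
  import Data.List.Relation.Unary.Linked.Properties as Linked
  open import Data.List.Relation.Unary.Unique.Propositional using (Unique)
  import Data.List.Relation.Unary.Unique.Propositional.Properties as Unique
  open import Data.Maybe using (just)
  open import Data.Maybe.Properties using (just-injective)
  open import Data.Maybe.Relation.Binary.Connected using (Connected; just)
  open import Data.Nat using (ℕ; zero; suc; _+_; _*_; _≤_; _<_; z≤n; s≤s; s≤s⁻¹; _≤?_; _<?_)
  open import Data.Nat.Properties
    using (≤-trans; ≤-reflexive; <⇒≤; ≰⇒>; ≮⇒≥; ≤⇒≯; <-≤-trans; n≤1+n; m≤m+n; +-suc; +-comm;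
           +-identityʳ; +-monoʳ-≤; +-mono-≤; +-cancelʳ-≤; *-monoʳ-≤; *-mono-≤; *-distribˡ-+;
           *-suc; *-zeroʳ; *-cancelˡ-<; *-commutativeSemigroup; module ≤-Reasoning)
  open import Algebra.Properties.CommutativeSemigroup *-commutativeSemigroup using (x∙yz≈y∙xz)
  open import Data.Product using (Σ; ∃; _×_; _,_; proj₂)
  open import Data.Sum using (_⊎_; inj₁; inj₂; [_,_])
  open import Data.Vec as Vec using ([]; _∷_; lookup)
  open import Data.Vec.Properties using (lookup∘tabulate; []=⇒lookup)
  open import Function using (_∘_)
  open import Relation.Binary.PropositionalEquality using (_≡_; _≢_; refl; sym; trans; cong; subst)
  open import Relation.Nullary using (yes; no; contradiction)
  open import Relation.Nullary.Decidable using (_×-dec_; ¬?; decidable-stable)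
  open import Relation.Unary using (Decidable)
  open import Defs

  module _ {a} {A : Set a} where

    last-++-∷ : ∀ (xs : List A) y ys → last (xs ++ y ∷ ys) ≡ last (y ∷ ys)
    last-++-∷ []            y ys = refl
    last-++-∷ (x ∷ [])      y ys = refl
    last-++-∷ (x ∷ x′ ∷ xs) y ys = last-++-∷ (x′ ∷ xs) y ys

    last-++ : ∀ (xs : List A) {v} ys → last xs ≡ just v → last (xs ++ ys) ≡ last (v ∷ ys)
    last-++ xs []       e = trans (cong last (++-identityʳ xs)) e
    last-++ xs (y ∷ ys) _ = last-++-∷ xs y ys

    Unique-++⁻ʳ : ∀ (xs : List A) {ys} → Unique (xs ++ ys) → Unique ys
    Unique-++⁻ʳ []       u       = u
    Unique-++⁻ʳ (x ∷ xs) (_ ∷ u) = Unique-++⁻ʳ xs u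

    Linked-++⁻ʳ : ∀ {ℓ} {R : A → A → Set ℓ} (xs : List A) {ys} → Linked R (xs ++ ys) → Linked R ys
    Linked-++⁻ʳ []       l = l
    Linked-++⁻ʳ (x ∷ xs) l = Linked-++⁻ʳ xs (Linked.tail l)

  ∣p∪q∣≤∣p∣+∣q∣ : ∀ {m} (p q : Subset m) → ∣ p ∪ q ∣ ≤ ∣ p ∣ + ∣ q ∣
  ∣p∪q∣≤∣p∣+∣q∣ []          []          = z≤n
  ∣p∪q∣≤∣p∣+∣q∣ (true ∷ p)  (true ∷ q)  = s≤s (≤-trans (∣p∪q∣≤∣p∣+∣q∣ p q) (+-monoʳ-≤ ∣ p ∣ (n≤1+n ∣ q ∣)))
  ∣p∪q∣≤∣p∣+∣q∣ (true ∷ p)  (false ∷ q) = s≤s (∣p∪q∣≤∣p∣+∣q∣ p q)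
  ∣p∪q∣≤∣p∣+∣q∣ (false ∷ p) (true ∷ q)  =
    subst (∣ true ∷ p ∪ q ∣ ≤_) (sym (+-suc ∣ p ∣ ∣ q ∣)) (s≤s (∣p∪q∣≤∣p∣+∣q∣ p q))
  ∣p∪q∣≤∣p∣+∣q∣ (false ∷ p) (false ∷ q) = ∣p∪q∣≤∣p∣+∣q∣ p q

  ∣p∣<∣p∪⁅x⁆∣ : ∀ {m} {p : Subset m} {x} → x ∉ p → ∣ p ∣ < ∣ p ∪ ⁅ x ⁆ ∣
  ∣p∣<∣p∪⁅x⁆∣ {x = x} x∉p = p⊂q⇒∣p∣<∣q∣ (p⊆p∪q ⁅ x ⁆ , x , x∈p∪q⁺ (inj₂ (x∈⁅x⁆ x)) , x∉p)

  x∈p⇒0<∣p∣ : ∀ {m} {p : Subset m} {x} → x ∈ p → 0 < ∣ p ∣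
  x∈p⇒0<∣p∣               Vec.here        = s≤s z≤n
  x∈p⇒0<∣p∣ {p = s ∷ p} (Vec.there x∈p) = ≤-trans (x∈p⇒0<∣p∣ x∈p) (∣p∣≤∣x∷p∣ s p)

  ∣p∣≤length : ∀ {m} {p : Subset m} xs → (∀ {y} → y ∈ p → y ∈ₗ xs) → ∣ p ∣ ≤ length xs
  ∣p∣≤length {m} {p} []       p⊆xs =
    subst (∣ p ∣ ≤_) (∣⊥∣≡0 m) (p⊆q⇒∣p∣≤∣q∣ {q = ⊥} (λ y∈p → contradiction (p⊆xs y∈p) λ ()))
  ∣p∣≤length {m} {p} (x ∷ xs) p⊆xs = begin
    ∣ p ∣               ≤⟨ p⊆q⇒∣p∣≤∣q∣ p⊆x∪p′ ⟩
    ∣ ⁅ x ⁆ ∪ p′ ∣      ≤⟨ ∣p∪q∣≤∣p∣+∣q∣ ⁅ x ⁆ p′ ⟩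
    ∣ ⁅ x ⁆ ∣ + ∣ p′ ∣  ≡⟨ cong (_+ ∣ p′ ∣) (∣⁅x⁆∣≡1 x) ⟩
    suc ∣ p′ ∣          ≤⟨ s≤s (∣p∣≤length xs p′⊆xs) ⟩
    suc (length xs)     ∎
    where
    open ≤-Reasoning
    p′ : Subset m
    p′ = p ∩ ∁ ⁅ x ⁆
    p⊆x∪p′ : ∀ {y} → y ∈ p → y ∈ ⁅ x ⁆ ∪ p′
    p⊆x∪p′ {y} y∈p with y ≟ x
    ... | yes refl = x∈p∪q⁺ (inj₁ (x∈⁅x⁆ x))
    ... | no y≢x   = x∈p∪q⁺ (inj₂ (x∈p∩q⁺ (y∈p , x∉p⇒x∈∁p (x≢y⇒x∉⁅y⁆ y≢x))))
    p′⊆xs : ∀ {y} → y ∈ p′ → y ∈ₗ xs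
    p′⊆xs y∈p′ with x∈p∩q⁻ p (∁ ⁅ x ⁆) y∈p′
    ... | y∈p , y∈∁x with p⊆xs y∈p
    ...   | here refl  = contradiction (x∈⁅x⁆ x) (x∈∁p⇒x∉p y∈∁x)
    ...   | there y∈xs = y∈xs

  x∈⋃⁻ : ∀ {m} {x : Fin m} ps → x ∈ ⋃ ps → Any (x ∈_) ps
  x∈⋃⁻ []       x∈⊥ = contradiction x∈⊥ ∉⊥
  x∈⋃⁻ (p ∷ ps) x∈  with x∈p∪q⁻ p (⋃ ps) x∈
  ... | inj₁ x∈p  = here x∈p
  ... | inj₂ x∈ps = there (x∈⋃⁻ ps x∈ps)

  x∈⋃⁺ : ∀ {m} {x : Fin m} {ps} → Any (x ∈_) ps → x ∈ ⋃ ps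
  x∈⋃⁺ (here x∈p)   = x∈p∪q⁺ (inj₁ x∈p)
  x∈⋃⁺ (there x∈ps) = x∈p∪q⁺ (inj₂ (x∈⋃⁺ x∈ps))

  balanced-subunion : ∀ {m} (Zs : List (Subset m)) → All (λ Z → 3 * ∣ Z ∣ ≤ 2 * m) Zs → m ≤ 3 * ∣ ⋃ Zs ∣ →
                      ∃ λ Ys → Ys ⊆ₗ Zs × m ≤ 3 * ∣ ⋃ Ys ∣ × 3 * ∣ ⋃ Ys ∣ ≤ 2 * m
  balanced-subunion {m} [] [] large = [] , (λ ()) , large , subst (λ k → 3 * k ≤ 2 * m) (sym (∣⊥∣≡0 m)) z≤n
  balanced-subunion {m} (Z ∷ Zs) (Z-small ∷ Zs-small) large with m ≤? 3 * ∣ ⋃ Zs ∣ | m ≤? 3 * ∣ Z ∣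
  ... | yes Zs-large | _ =
    let Ys , Ys⊆Zs , lower , upper = balanced-subunion Zs Zs-small Zs-large
    in Ys , there ∘ Ys⊆Zs , lower , upper
  ... | no _ | yes Z-large = Z ∷ [] , (λ { (here refl) → here refl }) , lower , upper
    where
    lower : m ≤ 3 * ∣ Z ∪ ⊥ ∣
    lower = subst (λ Y → m ≤ 3 * ∣ Y ∣) (sym (∪-identityʳ Z)) Z-large
    upper : 3 * ∣ Z ∪ ⊥ ∣ ≤ 2 * m
    upper = subst (λ Y → 3 * ∣ Y ∣ ≤ 2 * m) (sym (∪-identityʳ Z)) Z-small
  ... | no Zs-small′ | no Z-small′ = Z ∷ Zs , (λ Y∈ → Y∈) , large , upper
    where
    open ≤-Reasoning
    upper : 3 * ∣ Z ∪ ⋃ Zs ∣ ≤ 2 * m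
    upper = begin
      3 * ∣ Z ∪ ⋃ Zs ∣          ≤⟨ *-monoʳ-≤ 3 (∣p∪q∣≤∣p∣+∣q∣ Z (⋃ Zs)) ⟩
      3 * (∣ Z ∣ + ∣ ⋃ Zs ∣)     ≡⟨ *-distribˡ-+ 3 ∣ Z ∣ ∣ ⋃ Zs ∣ ⟩
      3 * ∣ Z ∣ + 3 * ∣ ⋃ Zs ∣   ≤⟨ +-mono-≤ (<⇒≤ (≰⇒> Z-small′)) (<⇒≤ (≰⇒> Zs-small′)) ⟩
      m + m                      ≡⟨ cong (m +_) (sym (+-identityʳ m)) ⟩
      2 * m                      ∎

  isIn≡lookup : ∀ {m} (U : Subset m) v → isIn U v ≡ lookup U v
  isIn≡lookup U v with lookup U v
  ... | true  = refl
  ... | false = refl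

  anyIn⁻ : ∀ {m} (U : Subset m) (P : Fin m → Bool) → anyIn U P ≡ true → ∃ λ u → u ∈ U × P u ≡ true
  anyIn⁻ (true ∷ U) P h with P zero in P0
  ... | true  = zero , Vec.here , P0
  ... | false = let u , u∈U , Pu = anyIn⁻ U (P ∘ suc) h in suc u , Vec.there u∈U , Pu
  anyIn⁻ (false ∷ U) P h = let u , u∈U , Pu = anyIn⁻ U (P ∘ suc) h in suc u , Vec.there u∈U , Pu

  module _ {n} (D : Digraph n) where

    ∈-outNbhd⁻ : ∀ {Z y} → y ∈ outNbhd D Z → y ∉ Z × ∃ λ z → z ∈ Z × ArcR D z y
    ∈-outNbhd⁻ {Z} {y} y∈N with split (isIn Z y) _ (trans (sym (lookup∘tabulate _ y)) ([]=⇒lookup y∈N))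
      where
      split : ∀ b c → fromBool (not b ∧ c) ≡ true → b ≡ false × c ≡ true
      split false true _ = refl , refl
    ... | isIn≡false , anyIn≡true =
      (λ y∈Z → contradiction (trans (sym isIn≡false) (trans (isIn≡lookup Z y) ([]=⇒lookup y∈Z))) λ ()) ,
      anyIn⁻ Z _ anyIn≡true

    record PathFrom (S : Subset n) (w z : Fin n) : Set where
      field
        rest   : List (Fin n)
        linked : Linked (ArcR D) (w ∷ rest)
        unique : Unique rest
        avoids : All (_∉ S) rest
        ends   : last (w ∷ rest) ≡ just z
    open PathFrom

    Child : Subset n → Fin n → Fin n → Set
    Child S w x = ArcR D w x × x ∉ S

    child? : ∀ S w → Decidable (Child S w)
    child? S w x = (arc D w x Bool.≟ true) ×-dec ¬? (x ∈? S)

    PathFrom-refl : ∀ {S w} → PathFrom S w w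
    PathFrom-refl = record { rest = [] ; linked = [-] ; unique = [] ; avoids = [] ; ends = refl }

    PathFrom-∷ : ∀ {S w x z} → Child S w x → PathFrom (S ∪ ⁅ x ⁆) x z → PathFrom S w z
    PathFrom-∷ {S} {w} {x} (wx , x∉S) P = record
      { rest   = x ∷ rest P
      ; linked = wx ∷ linked P
      ; unique = All.map (λ r∉ x≡r → r∉ (x∈p∪q⁺ (inj₂ (subst (_∈ ⁅ x ⁆) x≡r (x∈⁅x⁆ x))))) (avoids P) ∷ unique P
      ; avoids = x∉S ∷ All.map (λ r∉ r∈S → r∉ (x∈p∪q⁺ (inj₁ r∈S))) (avoids P)
      ; ends   = ends P
      }

    children : Subset n → Fin n → List (Fin n)
    children S w = filter (child? S w) (allFin n)

    children⁻ : ∀ {S w x} → x ∈ₗ children S w → Child S w x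
    children⁻ {S} {w} = proj₂ ∘ ∈-filter⁻ (child? S w) {xs = allFin n}

    -- reach k S w: the vertices reached from w by paths of length ≤ k whose later vertices
    -- avoid S.  Each step adds the vertex it enters to S, which keeps these paths simple.
    reach  : ℕ → Subset n → Fin n → Subset n
    branch : ℕ → Subset n → Fin n → Subset n
    reach zero    S w = ⁅ w ⁆
    reach (suc k) S w = ⁅ w ⁆ ∪ ⋃ (map (branch k S) (children S w))
    branch k S x = reach k (S ∪ ⁅ x ⁆) x

    reach-self : ∀ k {S w} → w ∈ reach k S w
    reach-self zero    {w = w} = x∈⁅x⁆ w
    reach-self (suc k) {w = w} = x∈p∪q⁺ (inj₁ (x∈⁅x⁆ w))

    branch⊆reach : ∀ {k S w x u} → Child S w x → u ∈ branch k S x → u ∈ reach (suc k) S w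
    branch⊆reach {S = S} {w} {x} c u∈ =
      x∈p∪q⁺ (inj₂ (x∈⋃⁺ (Any.map⁺ (lose (∈-filter⁺ (child? S w) (∈-allFin x) c) u∈))))

    reach-suc⁻ : ∀ {k S w u} → u ∈ reach (suc k) S w → u ≡ w ⊎ ∃ λ x → Child S w x × u ∈ branch k S x
    reach-suc⁻ {k} {S} {w} u∈ with x∈p∪q⁻ ⁅ w ⁆ _ u∈
    ... | inj₁ u∈w = inj₁ (x∈⁅y⁆⇒x≡y w u∈w)
    ... | inj₂ u∈⋃ with find (Any.map⁻ {f = branch k S} (x∈⋃⁻ (map (branch k S) (children S w)) u∈⋃))
    ...   | x , x∈cs , u∈x = inj₂ (x , children⁻ x∈cs , u∈x)

    reach-path : ∀ k {S w u} → u ∈ reach k S w → PathFrom S w u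
    reach-path zero    {w = w} u∈ with x∈⁅y⁆⇒x≡y w u∈
    ... | refl = PathFrom-refl
    reach-path (suc k) {S} {w} u∈ with reach-suc⁻ {k} {S} {w} u∈
    ... | inj₁ refl          = PathFrom-refl
    ... | inj₂ (x , c , u∈x) = PathFrom-∷ c (reach-path k {S ∪ ⁅ x ⁆} {x} u∈x)

    Closed : Subset n → Subset n → Set
    Closed S Z = ∀ {z y} → z ∈ Z → ArcR D z y → y ∉ S → y ∈ Z

    Closed-∪⁅⁆ : ∀ {S Z x} → x ∈ Z → Closed (S ∪ ⁅ x ⁆) Z → Closed S Z
    Closed-∪⁅⁆ {S} {x = x} x∈Z closed {y = y} z∈Z zy y∉S with y ≟ x
    ... | yes refl = x∈Z
    ... | no y≢x   = closed z∈Z zy λ y∈ → [ y∉S , y≢x ∘ x∈⁅y⁆⇒x≡y x ] (x∈p∪q⁻ S ⁅ x ⁆ y∈)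

    fuel-child : ∀ {k} {S : Subset n} {x} → x ∉ S → n ≤ suc k + ∣ S ∣ → n ≤ k + ∣ S ∪ ⁅ x ⁆ ∣
    fuel-child {k} {S} x∉S fuel =
      ≤-trans fuel (≤-trans (≤-reflexive (sym (+-suc k ∣ S ∣))) (+-monoʳ-≤ k (∣p∣<∣p∪⁅x⁆∣ x∉S)))

    -- Each step keeps n ≤ k + ∣ S ∣ while adding a vertex to S; when k reaches 0, S contains
    -- every vertex, so no arc can leave reach k S w.
    reach-closed  : ∀ k {S w} → n ≤ k + ∣ S ∣ → Closed S (reach k S w)
    branch-closed : ∀ k {S x} → n ≤ k + ∣ S ∪ ⁅ x ⁆ ∣ → Closed S (branch k S x)
    reach-closed zero {S} fuel {y = y} _ _ y∉S =
      contradiction (≤-trans (∣p∣<∣p∪⁅x⁆∣ y∉S) (∣p∣≤n (S ∪ ⁅ y ⁆))) (≤⇒≯ fuel)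
    reach-closed (suc k) {S} {w} fuel z∈ zy y∉S with reach-suc⁻ {k} {S} {w} z∈
    ... | inj₁ refl = branch⊆reach {k} (zy , y∉S) (reach-self k)
    ... | inj₂ (x , c@(_ , x∉S) , z∈x) =
      branch⊆reach {k} c (branch-closed k {S} {x} (fuel-child {k} x∉S fuel) z∈x zy y∉S)
    branch-closed k fuel = Closed-∪⁅⁆ (reach-self k) (reach-closed k fuel)

    record Trail (S : Subset n) (v : Fin n) : Set where
      field
        vertices : List (Fin n)
        unique   : Unique vertices
        linked   : Linked (ArcR D) vertices
        ends     : last vertices ≡ just v
        sound    : ∀ {y} → y ∈ₗ vertices → y ∈ S
        complete : ∀ {y} → y ∈ S → y ∈ₗ vertices
    open Trail

    Trail-[_] : ∀ v → Trail ⁅ v ⁆ v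
    Trail-[ v ] = record
      { vertices = v ∷ []
      ; unique   = [] ∷ []
      ; linked   = [-]
      ; ends     = refl
      ; sound    = λ { (here refl) → x∈⁅x⁆ v }
      ; complete = λ y∈v → here (x∈⁅y⁆⇒x≡y v y∈v)
      }

    Trail-∷ʳ : ∀ {S v x} → Trail S v → Child S v x → Trail (S ∪ ⁅ x ⁆) x
    Trail-∷ʳ {S} {v} {x} T (vx , x∉S) = record
      { vertices = vertices T ++ x ∷ []
      ; unique   = Unique.++⁺ (unique T) ([] ∷ []) λ { (x∈T , here refl) → x∉S (sound T x∈T) }
      ; linked   = Linked.++⁺ (linked T) (subst (λ l → Connected (ArcR D) l (just x)) (sym (ends T)) (just vx))
                              [-]
      ; ends     = last-++ (vertices T) (x ∷ []) (ends T)
      ; sound    = λ y∈ → [ x∈p∪q⁺ ∘ inj₁ ∘ sound T , (λ { (here refl) → x∈p∪q⁺ (inj₂ (x∈⁅x⁆ x)) }) ]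
                            (∈-++⁻ (vertices T) y∈)
      ; complete = λ y∈ → [ ∈-++⁺ˡ ∘ complete T , ∈-++⁺ʳ (vertices T) ∘ here ∘ x∈⁅y⁆⇒x≡y x ]
                            (x∈p∪q⁻ S ⁅ x ⁆ y∈)
      }

    record Hanging (S : Subset n) (v : Fin n) (Z : Subset n) : Set where
      field
        reachable : ∀ {z} → z ∈ Z → PathFrom S v z
        closed    : Closed S Z
    open Hanging

    Hanging-⋃ : ∀ {S v Zs} → All (Hanging S v) Zs → Hanging S v (⋃ Zs)
    Hanging-⋃ {Zs = Zs} hs = record
      { reachable = λ z∈ → let Z , Z∈ , z∈Z = find (x∈⋃⁻ Zs z∈) in reachable (All.lookup hs Z∈) z∈Z
      ; closed    = λ z∈ zy y∉S → let Z , Z∈ , z∈Z = find (x∈⋃⁻ Zs z∈) in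
                      x∈⋃⁺ (lose Z∈ (closed (All.lookup hs Z∈) z∈Z zy y∉S))
      }

    branch-hanging : ∀ {k S v x} → Child S v x → n ≤ suc k + ∣ S ∣ → Hanging S v (branch k S x)
    branch-hanging {k} {S} {v} {x} c@(_ , x∉S) fuel = record
      { reachable = PathFrom-∷ c ∘ reach-path k {S ∪ ⁅ x ⁆} {x}
      ; closed    = branch-closed k {S} {x} (fuel-child {k} x∉S fuel)
      }

    close-cycle : ∀ {S v y z post} → Unique (y ∷ post) → Linked (ArcR D) (y ∷ post) → last (y ∷ post) ≡ just v →
                  All (_∈ S) (y ∷ post) → PathFrom S v z → ArcR D z y → y ≢ z →
                  Σ (DirectedCycle D) λ C → length (y ∷ post) ≤ cycleLength C
    close-cycle {S} {v} {y} {z} {post} uniq lnk end inS P zy y≢z = C , length-++-≤ˡ (y ∷ post)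
      where
      end′ : last ((y ∷ post) ++ rest P) ≡ just z
      end′ = trans (last-++ (y ∷ post) (rest P) end) (ends P)
      junction : Connected (ArcR D) (last (y ∷ post)) (head (rest P))
      junction = subst (λ l → Connected (ArcR D) l (head (rest P))) (sym end) (Linked.head′ (linked P))
      two≤ : ∀ ws → last (y ∷ ws) ≡ just z → 2 ≤ length (y ∷ ws)
      two≤ []      e = contradiction (just-injective e) y≢z
      two≤ (_ ∷ _) _ = s≤s (s≤s z≤n)
      C : DirectedCycle D
      C = record
        { first    = y
        ; rest     = post ++ rest P
        ; long     = two≤ (post ++ rest P) end′
        ; distinct = Unique.++⁺ uniq (unique P) λ (w∈ys , w∈P) → All.lookup (avoids P) w∈P (All.lookup inS w∈ys)
        ; path     = Linked.++⁺ lnk junction (Linked.tail (linked P))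
        ; closing  = λ z′ e → subst (λ u → ArcR D u y) (just-injective (trans (sym end′) e)) zy
        }

    outNbhd⊆ : ∀ {S Z y} → Closed S Z → y ∈ outNbhd D Z → y ∈ S
    outNbhd⊆ {S} {y = y} closed y∈N with ∈-outNbhd⁻ y∈N | y ∈? S
    ... | _                  | yes y∈S = y∈S
    ... | y∉Z , z , z∈Z , zy | no y∉S  = contradiction (closed z∈Z zy y∉S) y∉Z

    cycle-through : ∀ {S v Z y} → Trail S v → Hanging S v Z → y ∈ outNbhd D Z →
                    Σ (DirectedCycle D) λ C → ∣ outNbhd D Z ∣ ≤ cycleLength C
    cycle-through {S} {v} {Z} T H y∈N =
      from-view (toView (¬All⇒First (λ x → ¬? (x ∈? N)) (decidable-stable (_ ∈? N))
                                    (λ all∉ → All.lookup all∉ (complete T (N⊆S y∈N)) y∈N)))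
                (unique T) (linked T) (ends T) (sound T) (complete T ∘ N⊆S)
      where
      N : Subset n
      N = outNbhd D Z
      N⊆S : ∀ {x} → x ∈ N → x ∈ S
      N⊆S = outNbhd⊆ (closed H)
      from-view : ∀ {Q} → First.FirstView (_∉ N) (_∈ N) Q → Unique Q → Linked (ArcR D) Q → last Q ≡ just v →
                  (∀ {x} → x ∈ₗ Q → x ∈ S) → (∀ {x} → x ∈ N → x ∈ₗ Q) →
                  Σ (DirectedCycle D) λ C → ∣ N ∣ ≤ cycleLength C
      from-view (First._++_∷_ {pre} {y} pre∉N y∈N post) uniq lnk end inS N⊆Q with ∈-outNbhd⁻ y∈N
      ... | y∉Z , z , z∈Z , zy =
        let C , suffix≤C = close-cycle (Unique-++⁻ʳ pre uniq) (Linked-++⁻ʳ pre lnk)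
                                       (trans (sym (last-++-∷ pre y post)) end)
                                       (All.tabulate (inS ∘ ∈-++⁺ʳ pre))
                                       (reachable H z∈Z) zy (λ { refl → y∉Z z∈Z })
        in C , ≤-trans (∣p∣≤length (y ∷ post) N⊆suffix) suffix≤C
        where
        N⊆suffix : ∀ {x} → x ∈ N → x ∈ₗ y ∷ post
        N⊆suffix x∈N with ∈-++⁻ pre (N⊆Q x∈N)
        ... | inj₁ x∈pre    = contradiction x∈N (All.lookup pre∉N x∈pre)
        ... | inj₂ x∈suffix = x∈suffix

    OutExpanding : ℕ → ℕ → Set
    OutExpanding p q = ∀ U → 3 * ∣ U ∣ ≤ 2 * n → p * ∣ U ∣ ≤ q * ∣ outNbhd D U ∣

    module _ {p q} (1≤p : 1 ≤ p) (2≤n : 2 ≤ n) (expanding : OutExpanding p q) where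

      LongCycle : Set
      LongCycle = Σ (DirectedCycle D) λ C → p * n ≤ q * (3 * cycleLength C)

      outNbhd-nonempty : ∀ {Z} → 0 < ∣ Z ∣ → 3 * ∣ Z ∣ ≤ 2 * n → Nonempty (outNbhd D Z)
      outNbhd-nonempty {Z} 0<∣Z∣ small with nonempty? (outNbhd D Z)
      ... | yes nonempty = nonempty
      ... | no  empty    = contradiction (begin
        1                     ≤⟨ *-mono-≤ 1≤p 0<∣Z∣ ⟩
        p * ∣ Z ∣             ≤⟨ expanding Z small ⟩
        q * ∣ outNbhd D Z ∣   ≡⟨ cong (λ N → q * ∣ N ∣) (Empty-unique empty) ⟩
        q * ∣ ⊥ {n} ∣         ≡⟨ cong (q *_) (∣⊥∣≡0 n) ⟩
        q * 0                 ≡⟨ *-zeroʳ q ⟩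
        0                     ∎) λ ()
        where open ≤-Reasoning

      balanced-long-cycle : ∀ {S v Z} → Trail S v → Hanging S v Z → n ≤ 3 * ∣ Z ∣ → 3 * ∣ Z ∣ ≤ 2 * n → LongCycle
      balanced-long-cycle {Z = Z} T H lower upper =
        let 0<∣Z∣   = *-cancelˡ-< 3 0 ∣ Z ∣ (<-≤-trans (≤-trans (s≤s z≤n) 2≤n) lower)
            y , y∈N = outNbhd-nonempty {Z} 0<∣Z∣ upper
            C , N≤C = cycle-through T H y∈N
        in C , (begin
          p * n                       ≤⟨ *-monoʳ-≤ p lower ⟩
          p * (3 * ∣ Z ∣)             ≡⟨ x∙yz≈y∙xz p 3 ∣ Z ∣ ⟩
          3 * (p * ∣ Z ∣)             ≤⟨ *-monoʳ-≤ 3 (expanding Z upper) ⟩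
          3 * (q * ∣ outNbhd D Z ∣)   ≤⟨ *-monoʳ-≤ 3 (*-monoʳ-≤ q N≤C) ⟩
          3 * (q * cycleLength C)     ≡⟨ x∙yz≈y∙xz 3 q (cycleLength C) ⟩
          q * (3 * cycleLength C)     ∎)
        where open ≤-Reasoning

      descend : ∀ k {S v} → Trail S v → n ≤ k + ∣ S ∣ → 2 * n < 3 * ∣ reach k S v ∣ → LongCycle
      descend zero {v = v} _ _ big =
        contradiction (subst (λ s → 2 * n < 3 * s) (∣⁅x⁆∣≡1 v) big) (≤⇒≯ (≤-trans (n≤1+n 3) (*-monoʳ-≤ 2 2≤n)))
      descend (suc k) {S} {v} T fuel big with any? (λ x → 2 * n <? 3 * ∣ branch k S x ∣) (children S v)
      ... | yes found =
        let x , x∈cs , big′ = find found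
            c = children⁻ x∈cs
        in descend k (Trail-∷ʳ T c) (fuel-child {k} (proj₂ c) fuel) big′
      ... | no none =
        let Ys , Ys⊆Zs , lower , upper = balanced-subunion Zs small large
        in balanced-long-cycle T (Hanging-⋃ (anti-mono Ys⊆Zs hanging)) lower upper
        where
        open ≤-Reasoning
        Zs : List (Subset n)
        Zs = map (branch k S) (children S v)
        hanging : All (Hanging S v) Zs
        hanging = All.map⁺ (All.tabulate λ x∈ → branch-hanging {k} (children⁻ x∈) fuel)
        small : All (λ Z → 3 * ∣ Z ∣ ≤ 2 * n) Zs
        small = All.map⁺ (All.map ≮⇒≥ (¬Any⇒All¬ (children S v) none))
        u : ℕ
        u = ∣ ⋃ Zs ∣
        big′ : 2 * n < 3 + 3 * u
        big′ = begin-strict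
          2 * n                  <⟨ big ⟩
          3 * ∣ ⁅ v ⁆ ∪ ⋃ Zs ∣   ≤⟨ *-monoʳ-≤ 3 (∣p∪q∣≤∣p∣+∣q∣ ⁅ v ⁆ (⋃ Zs)) ⟩
          3 * (∣ ⁅ v ⁆ ∣ + u)    ≡⟨ cong (λ s → 3 * (s + u)) (∣⁅x⁆∣≡1 v) ⟩
          3 * suc u              ≡⟨ *-suc 3 u ⟩
          3 + 3 * u              ∎
        large : n ≤ 3 * u
        large = +-cancelʳ-≤ 2 n (3 * u) (begin
          n + 2                  ≤⟨ +-monoʳ-≤ n 2≤n ⟩
          n + n                  ≡⟨ cong (n +_) (sym (+-identityʳ n)) ⟩
          2 * n                  ≤⟨ s≤s⁻¹ big′ ⟩
          2 + 3 * u              ≡⟨ +-comm 2 (3 * u) ⟩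
          3 * u + 2              ∎)

      long-cycle : LongCycle
      long-cycle = descend n Trail-[ v₀ ] fuel big
        where
        v₀ : Fin n
        v₀ = fromℕ< (≤-trans (s≤s z≤n) 2≤n)
        fuel : n ≤ n + ∣ ⁅ v₀ ⁆ ∣
        fuel = m≤m+n n _
        R : Subset n
        R = reach n ⁅ v₀ ⁆ v₀
        v₀∈R : v₀ ∈ R
        v₀∈R = reach-self n
        R-no-outNbhd : ∀ {y} → y ∉ outNbhd D R
        R-no-outNbhd y∈N with ∈-outNbhd⁻ {R} y∈N | x∈⁅y⁆⇒x≡y v₀ (outNbhd⊆ {⁅ v₀ ⁆} {R} (reach-closed n fuel) y∈N)
        ... | y∉R , _ | refl = y∉R v₀∈R
        big : 2 * n < 3 * ∣ R ∣
        big = ≰⇒> λ small → R-no-outNbhd (proj₂ (outNbhd-nonempty {R} (x∈p⇒0<∣p∣ v₀∈R) small))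

module Scaling where

  open import Data.Integer using (+_)
  import Data.Integer as ℤ
  open import Data.Integer.Properties using (pos-*; drop‿+≤+)
  open import Data.Nat using (suc; _*_; _≤_)
  open import Data.Nat.Properties using (*-identityʳ; *-comm)
  open import Data.Nat.Coprimality using (Coprime; 1-coprimeTo) renaming (sym to coprime-sym)
  open import Data.Rational as ℚ using (mkℚ; toℚᵘ)
  open import Data.Rational.Properties using (normalize-coprime; toℚᵘ-homo-*; toℚᵘ-mono-≤; toℚᵘ-cancel-≤)
  open import Data.Rational.Unnormalised using (mkℚᵘ; *≤*; *≡*; _≃_) renaming (_≤_ to _≤ᵘ_; _*_ to _*ᵘ_)
  open import Data.Rational.Unnormalised.Properties using (≃-trans; ≃-sym; ≤-respˡ-≃; ≤-respʳ-≃)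
  open import Function using (_⇔_; mk⇔; Equivalence)
  open import Relation.Binary.PropositionalEquality using (_≡_; sym; cong; cong₂; subst; subst₂)
  open import Defs using (ℕ→ℚ)

  ℕ→ℚ≡mkℚ : ∀ a → ℕ→ℚ a ≡ mkℚ (+ a) 0 (coprime-sym (1-coprimeTo a))
  ℕ→ℚ≡mkℚ a = normalize-coprime (coprime-sym (1-coprimeTo a))

  ≤ᵘ⇔cross-≤ : ∀ a c b d → mkℚᵘ (+ a) c ≤ᵘ mkℚᵘ (+ b) d ⇔ a * suc d ≤ b * suc c
  ≤ᵘ⇔cross-≤ a c b d = mk⇔
    (λ { (*≤* le) → drop‿+≤+ (subst₂ ℤ._≤_ (sym (pos-* a (suc d))) (sym (pos-* b (suc c))) le) })
    (λ le → *≤* (subst₂ ℤ._≤_ (pos-* a (suc d)) (pos-* b (suc c)) (ℤ.+≤+ le)))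

  toℚᵘ-*ℕ→ℚ : ∀ P d .(c : Coprime P (suc d)) a → toℚᵘ (mkℚ (+ P) d c ℚ.* ℕ→ℚ a) ≃ mkℚᵘ (+ (P * a)) d
  toℚᵘ-*ℕ→ℚ P d c a rewrite ℕ→ℚ≡mkℚ a =
    ≃-trans (toℚᵘ-homo-* (mkℚ (+ P) d c) (mkℚ (+ a) 0 (coprime-sym (1-coprimeTo a))))
            (*≡* (cong₂ ℤ._*_ (sym (pos-* P a)) (cong (λ k → + suc k) (sym (*-identityʳ d)))))

  mkℚ*a≤b⇒P*a≤[1+d]*b : ∀ P d .(c : Coprime P (suc d)) a b →
                         mkℚ (+ P) d c ℚ.* ℕ→ℚ a ℚ.≤ ℕ→ℚ b → P * a ≤ suc d * b
  mkℚ*a≤b⇒P*a≤[1+d]*b P d c a b le with toℚᵘ-mono-≤ le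
  ... | le′ rewrite ℕ→ℚ≡mkℚ b =
    subst₂ _≤_ (*-identityʳ (P * a)) (*-comm b (suc d))
      (Equivalence.to (≤ᵘ⇔cross-≤ (P * a) d b 0) (≤-respˡ-≃ (toℚᵘ-*ℕ→ℚ P d c a) le′))

  P*a≤[1+d]*[k*l]⇒mkℚ*a≤k*l : ∀ P d .(c : Coprime P (suc d)) a k l → P * a ≤ suc d * (k * l) →
                               mkℚ (+ P) d c ℚ.* ℕ→ℚ a ℚ.≤ ℕ→ℚ k ℚ.* ℕ→ℚ l
  P*a≤[1+d]*[k*l]⇒mkℚ*a≤k*l P d c a k l le = toℚᵘ-cancel-≤
    (≤-respʳ-≃ (≃-sym toℚᵘ-k*l) (≤-respˡ-≃ (≃-sym (toℚᵘ-*ℕ→ℚ P d c a))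
      (Equivalence.from (≤ᵘ⇔cross-≤ (P * a) d (k * l) 0)
        (subst₂ _≤_ (sym (*-identityʳ (P * a))) (*-comm (suc d) (k * l)) le))))
    where
    toℚᵘ-k*l : toℚᵘ (ℕ→ℚ k ℚ.* ℕ→ℚ l) ≃ mkℚᵘ (+ (k * l)) 0
    toℚᵘ-k*l rewrite ℕ→ℚ≡mkℚ k = toℚᵘ-*ℕ→ℚ k 0 _ l

open import Defs
open import Data.Nat using (ℕ)
open import Data.Rational using (ℚ; Positive; _≤_; _*_)
open import Data.Product using (Σ)
open import Data.Integer using (+_; -[1+_])
open import Data.Nat using (suc; s≤s; z≤n)
open import Data.Product using (_,_; proj₁)
open import Data.Rational using (mkℚ)
open import Data.Fin.Subset using (∣_∣)
open Combinatorics using (long-cycle)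
open Scaling

lemma2p4 : (α : ℚ) → Positive α → (n : ℕ) → (D : Digraph n) → IsExpander α D →
    Σ (DirectedCycle D) λ C → α * ℕ→ℚ n ≤ ℕ→ℚ 3 * ℕ→ℚ (cycleLength C)
lemma2p4 (mkℚ (+ 0) _ _) () _ _ _
lemma2p4 (mkℚ -[1+ _ ] _ _) () _ _ _
lemma2p4 (mkℚ (+ suc p) d c) _ n D (2≤n , expander) =
  let C , long = long-cycle D {suc p} {suc d} (s≤s z≤n) 2≤n λ U small →
                   mkℚ*a≤b⇒P*a≤[1+d]*b (suc p) d c ∣ U ∣ ∣ outNbhd D U ∣ (proj₁ (expander U small))
  in C , P*a≤[1+d]*[k*l]⇒mkℚ*a≤k*l (suc p) d c n 3 (cycleLength C) long
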